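{- Define numbers $\gamma_{n,p}$ for integers $n,p\ge 0$ by $\gamma_{0,p}=p+1$, $\gamma_{1,p}=p^2+p+1$, and $\gamma_{n+1,p}=\sum_{i=0}^{n}\gamma_{i,p}\,\gamma_{n-i,p+i}$ for $n\ge 1$. Then the number $c_n$ of compacted binary trees of size $n$ equals $\gamma_{n,0}$ for all $n\ge 0$.
   Context: A full binary tree is a rooted plane tree in which every node has $0$ or $2$ ordered children; a fringe subtree is a node with all its descendants. A compacted binary tree is the DAG obtained from a full binary tree $T$ by traversing it in post-order and replacing each edge leading to a fringe subtree identical to one already seen by a pointer to its first occurrence (deleting the duplicate). Distinct full binary trees give distinct compacted trees, and the size of the compacted tree (its number of internal nodes) is the number of distinct fringe subtrees of $T$ that are not a single leaf. Thus $c_n$ is the number of full binary trees having exactly $n$ distinct non-leaf fringe subtrees. -}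

module Defs where

open import Data.Nat using (ℕ; zero; suc; _+_; _*_; _∸_)
open import Data.List using (List; []; _∷_; _++_; length; deduplicate; map; upTo)
open import Data.Nat.ListAction using (sum)
open import Data.Product using (Σ)
open import Relation.Binary.PropositionalEquality using (_≡_; refl; cong₂)
open import Relation.Nullary using (Dec; yes; no)

data Tree : Set where
  leaf : Tree
  node : Tree → Tree → Tree

node-injˡ : ∀ {a b c d} → node a b ≡ node c d → a ≡ c
node-injˡ refl = refl

node-injʳ : ∀ {a b c d} → node a b ≡ node c d → b ≡ d
node-injʳ refl = refl

_≟T_ : (s t : Tree) → Dec (s ≡ t)
leaf ≟T leaf = yes refl
leaf ≟T node _ _ = no (λ ())
node _ _ ≟T leaf = no (λ ())
node a b ≟T node c d with a ≟T c | b ≟T d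
... | yes p | yes q = yes (cong₂ node p q)
... | no ¬p | _ = no (λ e → ¬p (node-injˡ e))
... | yes _ | no ¬q = no (λ e → ¬q (node-injʳ e))

internalFringes : Tree → List Tree
internalFringes leaf = []
internalFringes (node l r) = node l r ∷ (internalFringes l ++ internalFringes r)

-- Number of distinct non-leaf fringe subtrees of t
--  = size of the compacted binary tree of t.
compactedSize : Tree → ℕ
compactedSize t = length (deduplicate _≟T_ (internalFringes t))

-- Full binary trees whose compacted tree has size n
-- (these are in bijection with compacted binary trees of size n).
CompactedOfSize : ℕ → Set
CompactedOfSize n = Σ Tree (λ t → compactedSize t ≡ n)

gammaSum : (ℕ → ℕ → ℕ) → ℕ → ℕ → ℕ
gammaSum γ n p = sum (map (λ i → γ i p * γ (n ∸ i) (p + i)) (upTo (suc n)))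

-- Compaction is a post-order traversal that keeps the list S of distinct non-leaf fringe subtrees
-- met so far (the nodes of the compacted tree built so far); a tree t then adds some number of new
-- nodes to S, and with p = |S| the trees adding n nodes number γ_{n,p}.  A tree adding no node is
-- the leaf or one of the p trees of S.  A tree adding one node is node l r with l, r among those
-- p + 1 trees and node l r ∉ S; since S is closed under taking children, every element of S arises
-- from exactly one such pair, leaving (p + 1)² − p = γ_{1,p}.  A tree adding n + 1 ≥ 2 nodes is a
-- new root whose left subtree adds some i ≤ n nodes and whose right subtree adds the remaining
-- n − i to the enlarged list of size p + i, which is the recursion for γ_{n+1,p}.  Starting from
-- the empty list gives c_n = γ_{n,0}.

module Submission where

open import Defs
open import Data.Nat using (ℕ; zero; suc; _+_; _*_; _∸_; _≤_; _<_; z≤n; s≤s)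
open import Data.Nat.Properties
  using (≤-refl; ≤-trans; ≤-pred; m≤m+n; m≤n+m; n≤1+n; <-irrefl; m+n≡0⇒m≡0; m+n≡0⇒n≡0
        ; +-assoc; +-suc; +-identityʳ; suc-injective; m+n∸m≡n; m+[n∸m]≡n; ≤-irrelevant; ≡-irrelevant; 0≢1+n; m∸n≤m)
open import Data.Nat.Induction using (<-rec)
open import Data.Nat.Tactic.RingSolver using (solve-∀)
open import Data.Fin using (Fin; zero; suc)
open import Data.Fin.Properties using (+↔⊎; *↔×; 1↔⊤)
open import Data.List using (List; []; _∷_; length; lookup; map; applyUpTo; deduplicate)
open import Data.List.Properties using (map-applyUpTo)
open import Data.Nat.ListAction using (sum)
open import Data.List.Membership.Propositional using (_∈_; _∉_)
open import Data.List.Membership.Propositional.Properties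
  using (∈-++⁻; ∈-++⁺ˡ; ∈-++⁺ʳ; ∈-lookup; ∈-deduplicate⁻; ∈-deduplicate⁺)
open import Data.List.Membership.Propositional.Properties.WithK using (unique⇒irrelevant; unique∧set⇒bag)
open import Data.List.Membership.DecPropositional _≟T_ using (_∈?_)
open import Data.List.Relation.Unary.Any using (here; there; index)
open import Data.List.Relation.Unary.Any.Properties using (lookup-index)
open import Data.List.Relation.Unary.All.Properties using (¬Any⇒All¬)
open import Data.List.Relation.Unary.AllPairs using ([]; _∷_)
open import Data.List.Relation.Unary.Unique.Propositional using (Unique)
open import Data.List.Relation.Unary.Unique.DecPropositional.Properties _≟T_ using (deduplicate-!)
open import Data.List.Relation.Binary.BagAndSetEquality using (∼bag⇒↭)
open import Data.List.Relation.Binary.Permutation.Propositional.Properties using (↭-length)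
open import Data.Product using (Σ; ∃; _×_; _,_; proj₁; proj₂)
import Data.Product as Product
open import Data.Product.Function.Dependent.Propositional using (congˡ) renaming (cong to Σ-cong)
open import Data.Product.Function.NonDependent.Propositional using (_×-↔_)
open import Data.Sum using (_⊎_; inj₁; inj₂; [_,_]′)
import Data.Sum as Sum
open import Data.Sum.Function.Propositional using (_⊎-↔_)
open import Data.Sum.Properties using (inj₂-injective)
open import Data.Unit using (⊤; tt)
open import Data.Empty using (⊥-elim)
open import Function.Base using (_∘_; id)
open import Function.Bundles using (_↔_; _⇔_; Inverse; mk↔ₛ′; mk⇔)
open import Function.Properties.Inverse using (↔-refl; ↔-sym; ↔-trans)
open import Function.Related.Propositional as Related using (K-reflexive)
open import Axiom.UniquenessOfIdentityProofs.WithK using (uip)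
open import Relation.Nullary using (Dec; yes; no; Irrelevant)
open import Relation.Binary.PropositionalEquality
  using (_≡_; refl; sym; trans; cong; cong₂; subst; module ≡-Reasoning)

private
  variable
    A B : Set

-- Bijections between finite types

proj₁-injective : {P : A → Set} → (∀ {x} → Irrelevant (P x)) →
                  {u v : Σ A P} → proj₁ u ≡ proj₁ v → u ≡ v
proj₁-injective irr {a , p} {.a , q} refl = cong (a ,_) (irr p q)

-- Cancelling ⊤ reroutes an element sent to the extra point through the image of that point.
data Image (f : ⊤ ⊎ A → ⊤ ⊎ B) (a : A) (b : B) : Set where
  direct : f (inj₂ a) ≡ inj₂ b → Image f a b
  detour : f (inj₂ a) ≡ inj₁ tt → f (inj₁ tt) ≡ inj₂ b → Image f a b

Image-functional : {f : ⊤ ⊎ A → ⊤ ⊎ B} {a : A} {b b′ : B} → Image f a b → Image f a b′ → b ≡ b′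
Image-functional (direct p) (direct q) = inj₂-injective (trans (sym p) q)
Image-functional (direct p) (detour q _) with () ← trans (sym p) q
Image-functional (detour p _) (direct q) with () ← trans (sym p) q
Image-functional (detour _ p) (detour _ q) = inj₂-injective (trans (sym p) q)

module _ (e : (⊤ ⊎ A) ↔ (⊤ ⊎ B)) where
  open Inverse e

  Image-exists : ∀ a → ∃ (Image to a)
  Image-exists a with to (inj₂ a) in p
  ... | inj₂ b = b , direct p
  ... | inj₁ tt with to (inj₁ tt) in q
  ...   | inj₂ b = b , detour p q
  ...   | inj₁ tt with () ← trans (sym (inverseʳ (sym p))) (inverseʳ (sym q))

  Image-flip : ∀ {a b} → Image to a b → Image from b a
  Image-flip (direct p) = direct (inverseʳ (sym p))
  Image-flip (detour p q) = detour (inverseʳ (sym q)) (inverseʳ (sym p))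

⊤⊎-cancelˡ : (⊤ ⊎ A) ↔ (⊤ ⊎ B) → A ↔ B
⊤⊎-cancelˡ e = mk↔ₛ′ (proj₁ ∘ image) (proj₁ ∘ preimage)
  (λ b → Image-functional (proj₂ (image _)) (Image-flip (↔-sym e) (proj₂ (preimage b))))
  (λ a → Image-functional (proj₂ (preimage _)) (Image-flip e (proj₂ (image a))))
  where
  image : ∀ a → ∃ (Image (Inverse.to e) a)
  image = Image-exists e
  preimage : ∀ b → ∃ (Image (Inverse.from e) b)
  preimage = Image-exists (↔-sym e)

Fin-zero-⊎ : (Fin 0 ⊎ A) ↔ A
Fin-zero-⊎ = mk↔ₛ′ [ (λ ()) , id ]′ inj₂ (λ _ → refl) λ { (inj₂ _) → refl ; (inj₁ ()) }

Fin-suc-⊎ : ∀ {n} → (Fin (suc n) ⊎ A) ↔ (⊤ ⊎ (Fin n ⊎ A))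
Fin-suc-⊎ = mk↔ₛ′
  (λ { (inj₁ zero) → inj₁ tt ; (inj₁ (suc i)) → inj₂ (inj₁ i) ; (inj₂ a) → inj₂ (inj₂ a) })
  (λ { (inj₁ tt) → inj₁ zero ; (inj₂ (inj₁ i)) → inj₁ (suc i) ; (inj₂ (inj₂ a)) → inj₂ a })
  (λ { (inj₁ tt) → refl ; (inj₂ (inj₁ i)) → refl ; (inj₂ (inj₂ a)) → refl })
  (λ { (inj₁ zero) → refl ; (inj₁ (suc i)) → refl ; (inj₂ a) → refl })

Fin⊎-cancelˡ : ∀ n → (Fin n ⊎ A) ↔ (Fin n ⊎ B) → A ↔ B
Fin⊎-cancelˡ zero e = ↔-trans (↔-sym Fin-zero-⊎) (↔-trans e Fin-zero-⊎)
Fin⊎-cancelˡ (suc n) e =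
  Fin⊎-cancelˡ n (⊤⊎-cancelˡ (↔-trans (↔-sym Fin-suc-⊎) (↔-trans e Fin-suc-⊎)))

index-∈-lookup : ∀ (xs : List A) i → index (∈-lookup {xs = xs} i) ≡ i
index-∈-lookup (x ∷ xs) zero = refl
index-∈-lookup (x ∷ xs) (suc i) = cong suc (index-∈-lookup xs i)

∈↔Fin : {xs : List A} → Unique xs → ∃ (_∈ xs) ↔ Fin (length xs)
∈↔Fin {xs = xs} u = mk↔ₛ′ (index ∘ proj₂) (λ i → lookup xs i , ∈-lookup i) (index-∈-lookup xs)
  (λ (_ , x∈) → proj₁-injective (unique⇒irrelevant u) (sym (lookup-index x∈)))

Σ<-suc↔ : ∀ {m} {P : ℕ → Set} →
          Σ ℕ (λ i → i < suc m × P i) ↔ (P 0 ⊎ Σ ℕ (λ i → i < m × P (suc i)))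
Σ<-suc↔ = mk↔ₛ′
  (λ { (zero , _ , p) → inj₁ p ; (suc i , s≤s i<m , p) → inj₂ (i , i<m , p) })
  (λ { (inj₁ p) → 0 , s≤s z≤n , p ; (inj₂ (i , i<m , p)) → suc i , s≤s i<m , p })
  (λ { (inj₁ p) → refl ; (inj₂ _) → refl })
  (λ { (zero , s≤s z≤n , p) → refl ; (suc i , s≤s i<m , p) → refl })

Fin-sum↔Σ< : (f : ℕ → ℕ) (m : ℕ) → Fin (sum (applyUpTo f m)) ↔ Σ ℕ (λ i → i < m × Fin (f i))
Fin-sum↔Σ< f zero = mk↔ₛ′ (λ ()) (λ { (_ , () , _) }) (λ { (_ , () , _) }) (λ ())
Fin-sum↔Σ< f (suc m) = begin
  Fin (f 0 + sum (applyUpTo (f ∘ suc) m))           ↔⟨ +↔⊎ ⟩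
  (Fin (f 0) ⊎ Fin (sum (applyUpTo (f ∘ suc) m)))   ↔⟨ ↔-refl ⊎-↔ Fin-sum↔Σ< (f ∘ suc) m ⟩
  (Fin (f 0) ⊎ Σ ℕ (λ i → i < m × Fin (f (suc i)))) ↔⟨ Σ<-suc↔ ⟨
  Σ ℕ (λ i → i < suc m × Fin (f i))                 ∎
  where open Related.EquationalReasoning

Σ-+≡↔Σ< : (f : A → ℕ) (g : A → B → ℕ) (n : ℕ) →
          Σ A (λ a → Σ B (λ b → f a + g a b ≡ n)) ↔
          Σ ℕ (λ i → i < suc n × Σ (Σ A (λ a → f a ≡ i)) (λ a → Σ B (λ b → g (proj₁ a) b ≡ n ∸ i)))
Σ-+≡↔Σ< f g n = mk↔ₛ′
  (λ (a , b , e) → f a , s≤s (subst (f a ≤_) e (m≤m+n (f a) (g a b))) , (a , refl) ,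
                   (b , trans (sym (m+n∸m≡n (f a) (g a b))) (cong (_∸ f a) e)))
  (λ { (_ , i<1+n , (a , refl) , (b , e)) →
       a , b , trans (cong (f a +_) e) (m+[n∸m]≡n (≤-pred i<1+n)) })
  (λ { (_ , _ , (a , refl) , (b , _)) →
       cong₂ (λ lt e → f a , lt , (a , refl) , (b , e)) (≤-irrelevant _ _) (≡-irrelevant _ _) })
  (λ (a , b , _) → cong (λ e → a , b , e) (≡-irrelevant _ _))

-- Fringe subtrees

size : Tree → ℕ
size leaf = 0
size (node l r) = suc (size l + size r)

size-fringe : ∀ {x} t → x ∈ internalFringes t → size x ≤ size t
size-fringe (node l r) (here refl) = ≤-refl
size-fringe (node l r) (there x∈) with ∈-++⁻ (internalFringes l) x∈
... | inj₁ x∈l = ≤-trans (size-fringe l x∈l) (≤-trans (m≤m+n (size l) (size r)) (n≤1+n _))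
... | inj₂ x∈r = ≤-trans (size-fringe r x∈r) (≤-trans (m≤n+m (size r) (size l)) (n≤1+n _))

node∉fringesˡ : ∀ l r → node l r ∉ internalFringes l
node∉fringesˡ l r t∈ = <-irrefl refl (≤-trans (s≤s (m≤m+n (size l) (size r))) (size-fringe l t∈))

node∉fringesʳ : ∀ l r → node l r ∉ internalFringes r
node∉fringesʳ l r t∈ = <-irrefl refl (≤-trans (s≤s (m≤n+m (size r) (size l))) (size-fringe r t∈))

-- Post-order compaction against a dictionary of already compacted subtrees

Seen : List Tree → Tree → Set
Seen S t = t ≡ leaf ⊎ t ∈ S

record Dictionary (S : List Tree) : Set where
  field
    unique   : Unique S
    leaf∉    : leaf ∉ S
    children : ∀ {l r} → node l r ∈ S → Seen S l × Seen S r
open Dictionary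

extend : List Tree → Tree → List Tree
extend S leaf = S
extend S (node l r) with node l r ∈? S
... | yes _ = S
... | no _ = node l r ∷ extend (extend S l) r

mutual
  newCount : List Tree → Tree → ℕ
  newCount S leaf = 0
  newCount S (node l r) with node l r ∈? S
  ... | yes _ = 0
  ... | no _ = suc (childCount S l r)

  childCount : List Tree → Tree → Tree → ℕ
  childCount S l r = newCount S l + newCount (extend S l) r

Adding : List Tree → ℕ → Set
Adding S n = Σ Tree (λ t → newCount S t ≡ n)

Adding-≡ : ∀ {S n} {u v : Adding S n} → proj₁ u ≡ proj₁ v → u ≡ v
Adding-≡ = proj₁-injective ≡-irrelevant

Seen-irrelevant : ∀ {S t} → Dictionary S → Irrelevant (Seen S t)
Seen-irrelevant d (inj₁ p) (inj₁ q) = cong inj₁ (uip p q)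
Seen-irrelevant d (inj₁ refl) (inj₂ leaf∈) = ⊥-elim (leaf∉ d leaf∈)
Seen-irrelevant d (inj₂ leaf∈) (inj₁ refl) = ⊥-elim (leaf∉ d leaf∈)
Seen-irrelevant d (inj₂ p) (inj₂ q) = cong inj₂ (unique⇒irrelevant (unique d) p q)

∈-extend⁺ : ∀ {x} S t → x ∈ S → x ∈ extend S t
∈-extend⁺ S leaf x∈ = x∈
∈-extend⁺ S (node l r) x∈ with node l r ∈? S
... | yes _ = x∈
... | no _ = there (∈-extend⁺ (extend S l) r (∈-extend⁺ S l x∈))

Seen-extend⁺ : ∀ {x} S t → Seen S x → Seen (extend S t) x
Seen-extend⁺ S t = Sum.map₂ (∈-extend⁺ S t)

Seen-extend : ∀ S t → Seen (extend S t) t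
Seen-extend S leaf = inj₁ refl
Seen-extend S (node l r) with node l r ∈? S
... | yes t∈ = inj₂ t∈
... | no _ = inj₂ (here refl)

∈-extend⁻ : ∀ {x} S t → x ∈ extend S t → x ∈ S ⊎ x ∈ internalFringes t
∈-extend⁻ S leaf x∈ = inj₁ x∈
∈-extend⁻ S (node l r) x∈ with node l r ∈? S
... | yes _ = inj₁ x∈
∈-extend⁻ S (node l r) (here refl) | no _ = inj₂ (here refl)
∈-extend⁻ S (node l r) (there x∈) | no _ with ∈-extend⁻ (extend S l) r x∈
... | inj₂ x∈r = inj₂ (there (∈-++⁺ʳ (internalFringes l) x∈r))
... | inj₁ x∈′ = Sum.map₂ (there ∘ ∈-++⁺ˡ) (∈-extend⁻ S l x∈′)

extend-Seen : ∀ {S} t → Seen S t → extend S t ≡ S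
extend-Seen leaf _ = refl
extend-Seen {S} (node l r) (inj₂ t∈) with node l r ∈? S
... | yes _ = refl
... | no t∉ = ⊥-elim (t∉ t∈)

newCount-Seen : ∀ {S} t → Seen S t → newCount S t ≡ 0
newCount-Seen leaf _ = refl
newCount-Seen {S} (node l r) (inj₂ t∈) with node l r ∈? S
... | yes _ = refl
... | no t∉ = ⊥-elim (t∉ t∈)

newCount≡0⇒Seen : ∀ S t → newCount S t ≡ 0 → Seen S t
newCount≡0⇒Seen S leaf _ = inj₁ refl
newCount≡0⇒Seen S (node l r) h with node l r ∈? S
... | yes t∈ = inj₂ t∈
newCount≡0⇒Seen S (node l r) () | no _

newCount-∉ : ∀ {S l r} → node l r ∉ S → newCount S (node l r) ≡ suc (childCount S l r)
newCount-∉ {S} {l} {r} t∉ with node l r ∈? S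
... | yes t∈ = ⊥-elim (t∉ t∈)
... | no _ = refl

newCount≡1+n⇒childCount≡n : ∀ {S l r n} → newCount S (node l r) ≡ suc n → childCount S l r ≡ n
newCount≡1+n⇒childCount≡n {S} {l} {r} h with node l r ∈? S
newCount≡1+n⇒childCount≡n () | yes _
... | no _ = suc-injective h

childCount-Seen : ∀ {S l r} → Seen S l × Seen S r → childCount S l r ≡ 0
childCount-Seen {S} {l} {r} (sl , sr) = cong₂ _+_ (newCount-Seen l sl)
  (trans (cong (λ S′ → newCount S′ r) (extend-Seen l sl)) (newCount-Seen r sr))

childCount≡0⇒Seen : ∀ {S l r} → childCount S l r ≡ 0 → Seen S l × Seen S r
childCount≡0⇒Seen {S} {l} {r} h = sl ,
  newCount≡0⇒Seen S r (subst (λ S′ → newCount S′ r ≡ 0) (extend-Seen l sl) (m+n≡0⇒n≡0 (newCount S l) h))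
  where
  sl : Seen S l
  sl = newCount≡0⇒Seen S l (m+n≡0⇒m≡0 _ h)

length-extend : ∀ S t → length (extend S t) ≡ length S + newCount S t
length-extend S leaf = sym (+-identityʳ _)
length-extend S (node l r) with node l r ∈? S
... | yes _ = sym (+-identityʳ _)
... | no _ = begin
  suc (length (extend (extend S l) r))                        ≡⟨ cong suc (length-extend (extend S l) r) ⟩
  suc (length (extend S l) + newCount (extend S l) r)          ≡⟨ cong (λ k → suc (k + newCount (extend S l) r)) (length-extend S l) ⟩
  suc (length S + newCount S l + newCount (extend S l) r)      ≡⟨ cong suc (+-assoc (length S) _ _) ⟩
  suc (length S + childCount S l r)                            ≡⟨ +-suc (length S) _ ⟨
  length S + suc (childCount S l r)                            ∎
  where open ≡-Reasoning

dictionary-[] : Dictionary []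
dictionary-[] = record { unique = [] ; leaf∉ = λ () ; children = λ () }

Dictionary-extend : ∀ {S} t → Dictionary S → Dictionary (extend S t)
Dictionary-extend leaf d = d
Dictionary-extend {S} (node l r) d with node l r ∈? S
... | yes _ = d
... | no t∉S = record
  { unique   = ¬Any⇒All¬ E t∉E ∷ unique dE
  ; leaf∉    = λ { (there leaf∈) → leaf∉ dE leaf∈ }
  ; children = λ { (here refl) → Seen-∷⁺ (Seen-extend⁺ (extend S l) r (Seen-extend S l)) ,
                                 Seen-∷⁺ (Seen-extend (extend S l) r)
                 ; (there t∈) → Product.map Seen-∷⁺ Seen-∷⁺ (children dE t∈) }
  }
  where
  E : List Tree
  E = extend (extend S l) r
  dE : Dictionary E
  dE = Dictionary-extend r (Dictionary-extend l d)
  Seen-∷⁺ : ∀ {x} → Seen E x → Seen (node l r ∷ E) x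
  Seen-∷⁺ = Sum.map₂ there
  t∉E : node l r ∉ E
  t∉E t∈ with ∈-extend⁻ (extend S l) r t∈
  ... | inj₂ t∈r = node∉fringesʳ l r t∈r
  ... | inj₁ t∈′ = [ t∉S , node∉fringesˡ l r ]′ (∈-extend⁻ S l t∈′)

fringes-Seen : ∀ {S y} → Dictionary S → ∀ x → Seen S x → y ∈ internalFringes x → y ∈ S
fringes-Seen d (node l r) (inj₂ x∈) (here refl) = x∈
fringes-Seen d (node l r) (inj₂ x∈) (there y∈) with children d x∈ | ∈-++⁻ (internalFringes l) y∈
... | sl , _ | inj₁ y∈l = fringes-Seen d l sl y∈l
... | _ , sr | inj₂ y∈r = fringes-Seen d r sr y∈r

fringes⊆extend : ∀ {S y} → Dictionary S → ∀ t → y ∈ internalFringes t → y ∈ extend S t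
fringes⊆extend {S} d t = fringes-Seen (Dictionary-extend t d) t (Seen-extend S t)

compactedSize≡newCount : ∀ t → compactedSize t ≡ newCount [] t
compactedSize≡newCount t = trans (↭-length (∼bag⇒↭ (unique∧set⇒bag
    (deduplicate-! (internalFringes t)) (unique (Dictionary-extend t dictionary-[])) same-elements)))
  (length-extend [] t)
  where
  same-elements : ∀ {y} → y ∈ deduplicate _≟T_ (internalFringes t) ⇔ y ∈ extend [] t
  same-elements = mk⇔ (fringes⊆extend dictionary-[] t ∘ ∈-deduplicate⁻ _≟T_ (internalFringes t))
                      ([ (λ ()) , ∈-deduplicate⁺ _≟T_ ]′ ∘ ∈-extend⁻ [] t)

-- Counting trees by the number of new nodes they add

Adding-zero↔ : ∀ {S} → Dictionary S → Adding S 0 ↔ (∃ (_∈ S) ⊎ ⊤)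
Adding-zero↔ {S} d = mk↔ₛ′ to from to-from from-to
  where
  classify : ∀ {t} → Seen S t → ∃ (_∈ S) ⊎ ⊤
  classify (inj₁ _) = inj₂ tt
  classify {t} (inj₂ t∈) = inj₁ (t , t∈)
  to : Adding S 0 → ∃ (_∈ S) ⊎ ⊤
  to (t , h) = classify (newCount≡0⇒Seen S t h)
  from : ∃ (_∈ S) ⊎ ⊤ → Adding S 0
  from (inj₁ (t , t∈)) = t , newCount-Seen t (inj₂ t∈)
  from (inj₂ tt) = leaf , refl
  to-from : ∀ y → to (from y) ≡ y
  to-from (inj₁ (t , t∈)) = cong classify (Seen-irrelevant d _ (inj₂ t∈))
  to-from (inj₂ tt) = refl
  from-classify : ∀ {t} (s : Seen S t) → proj₁ (from (classify s)) ≡ t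
  from-classify (inj₁ refl) = refl
  from-classify (inj₂ _) = refl
  from-to : ∀ x → from (to x) ≡ x
  from-to (t , h) = Adding-≡ (from-classify (newCount≡0⇒Seen S t h))

Adding-one↔ : ∀ {S} → Dictionary S → (Adding S 0 × Adding S 0) ↔ (∃ (_∈ S) ⊎ Adding S 1)
Adding-one↔ {S} d = mk↔ₛ′ to from to-from from-to
  where
  pair : ∀ {l r} → Seen S l × Seen S r → Adding S 0 × Adding S 0
  pair {l} {r} (sl , sr) = (l , newCount-Seen l sl) , (r , newCount-Seen r sr)

  classify : ∀ {l r} → Seen S l → Seen S r → Dec (node l r ∈ S) → ∃ (_∈ S) ⊎ Adding S 1
  classify {l} {r} _ _ (yes t∈) = inj₁ (node l r , t∈)
  classify {l} {r} sl sr (no t∉) = inj₂ (node l r , trans (newCount-∉ t∉) (cong suc (childCount-Seen (sl , sr))))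

  to : Adding S 0 × Adding S 0 → ∃ (_∈ S) ⊎ Adding S 1
  to ((l , hl) , (r , hr)) = classify (newCount≡0⇒Seen S l hl) (newCount≡0⇒Seen S r hr) (node l r ∈? S)

  from : ∃ (_∈ S) ⊎ Adding S 1 → Adding S 0 × Adding S 0
  from (inj₁ (leaf , leaf∈)) = ⊥-elim (leaf∉ d leaf∈)
  from (inj₁ (node l r , t∈)) = pair (children d t∈)
  from (inj₂ (node l r , h)) = pair (childCount≡0⇒Seen {S} {l} (newCount≡1+n⇒childCount≡n {S} {l} h))

  classify-∈ : ∀ {l r} sl sr dec (t∈ : node l r ∈ S) → classify sl sr dec ≡ inj₁ (node l r , t∈)
  classify-∈ _ _ (yes t∈′) t∈ = cong (λ t∈″ → inj₁ (_ , t∈″)) (unique⇒irrelevant (unique d) t∈′ t∈)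
  classify-∈ _ _ (no t∉) t∈ = ⊥-elim (t∉ t∈)

  classify-∉ : ∀ {l r} sl sr dec → node l r ∉ S → (h : newCount S (node l r) ≡ 1) →
               classify sl sr dec ≡ inj₂ (node l r , h)
  classify-∉ _ _ (yes t∈) t∉ _ = ⊥-elim (t∉ t∈)
  classify-∉ _ _ (no _) _ _ = cong inj₂ (Adding-≡ refl)

  to-from : ∀ y → to (from y) ≡ y
  to-from (inj₁ (leaf , leaf∈)) = ⊥-elim (leaf∉ d leaf∈)
  to-from (inj₁ (node l r , t∈)) = classify-∈ _ _ (node l r ∈? S) t∈
  to-from (inj₂ (node l r , h)) = classify-∉ _ _ (node l r ∈? S)
    (λ t∈ → 0≢1+n (trans (sym (newCount-Seen _ (inj₂ t∈))) h)) h

  from-classify : ∀ {l r} sl sr dec {hl hr} → from (classify {l} {r} sl sr dec) ≡ ((l , hl) , (r , hr))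
  from-classify _ _ (yes _) = cong₂ _,_ (Adding-≡ refl) (Adding-≡ refl)
  from-classify _ _ (no _) = cong₂ _,_ (Adding-≡ refl) (Adding-≡ refl)

  from-to : ∀ x → from (to x) ≡ x
  from-to ((l , _) , (r , _)) = from-classify _ _ (node l r ∈? S)

Adding-node↔ : ∀ {S n} → Dictionary S →
               Adding S (suc (suc n)) ↔ Σ Tree (λ l → Σ Tree (λ r → childCount S l r ≡ suc n))
Adding-node↔ {S} {n} d = mk↔ₛ′ to from (λ (l , r , _) → cong (λ e → l , r , e) (≡-irrelevant _ _)) from-to
  where
  to : Adding S (suc (suc n)) → Σ Tree (λ l → Σ Tree (λ r → childCount S l r ≡ suc n))
  to (node l r , h) = l , r , newCount≡1+n⇒childCount≡n {S} {l} h
  from : Σ Tree (λ l → Σ Tree (λ r → childCount S l r ≡ suc n)) → Adding S (suc (suc n))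
  from (l , r , e) = node l r , trans (newCount-∉ t∉) (cong suc e)
    where
    t∉ : node l r ∉ S
    t∉ t∈ = 0≢1+n (trans (sym (childCount-Seen (children d t∈))) e)
  from-to : ∀ x → from (to x) ≡ x
  from-to (node l r , _) = Adding-≡ refl

Fin↔Adding-zero : ∀ {S} → Dictionary S → Fin (length S + 1) ↔ Adding S 0
Fin↔Adding-zero {S} d = begin
  Fin (length S + 1)         ↔⟨ +↔⊎ ⟩
  (Fin (length S) ⊎ Fin 1)   ↔⟨ ↔-sym (∈↔Fin (unique d)) ⊎-↔ 1↔⊤ ⟩
  (∃ (_∈ S) ⊎ ⊤)             ↔⟨ Adding-zero↔ d ⟨
  Adding S 0                 ∎
  where open Related.EquationalReasoning

Fin↔Adding-one : ∀ {S} → Dictionary S → let p = length S in Fin (p * p + p + 1) ↔ Adding S 1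
Fin↔Adding-one {S} d = Fin⊎-cancelˡ p (begin
  (Fin p ⊎ Fin (p * p + p + 1))   ↔⟨ +↔⊎ ⟨
  Fin (p + (p * p + p + 1))       ≡⟨ cong Fin (square p) ⟩
  Fin ((p + 1) * (p + 1))         ↔⟨ *↔× ⟩
  (Fin (p + 1) × Fin (p + 1))     ↔⟨ Fin↔Adding-zero d ×-↔ Fin↔Adding-zero d ⟩
  (Adding S 0 × Adding S 0)       ↔⟨ Adding-one↔ d ⟩
  (∃ (_∈ S) ⊎ Adding S 1)         ↔⟨ ∈↔Fin (unique d) ⊎-↔ ↔-refl ⟩
  (Fin p ⊎ Adding S 1)            ∎)
  where
  open Related.EquationalReasoning
  p : ℕ
  p = length S
  square : ∀ p → p + (p * p + p + 1) ≡ (p + 1) * (p + 1)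
  square = solve-∀

Adding-[]↔CompactedOfSize : ∀ n → Adding [] n ↔ CompactedOfSize n
Adding-[]↔CompactedOfSize n = congˡ λ {t} → K-reflexive (cong (_≡ n) (sym (compactedSize≡newCount t)))

module _ (γ : ℕ → ℕ → ℕ)
         (γ-zero : ∀ p → γ 0 p ≡ p + 1)
         (γ-one : ∀ p → γ 1 p ≡ p * p + p + 1)
         (γ-suc : ∀ n p → 1 ≤ n → γ (suc n) p ≡ gammaSum γ n p) where

  Fin-γ↔Adding : ∀ n {S} → Dictionary S → Fin (γ n (length S)) ↔ Adding S n
  Fin-γ↔Adding = <-rec _ step
    where
    step : ∀ n → (∀ {m} → m < n → ∀ {S} → Dictionary S → Fin (γ m (length S)) ↔ Adding S m) →
           ∀ {S} → Dictionary S → Fin (γ n (length S)) ↔ Adding S n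
    step zero _ d = ↔-trans (K-reflexive (cong Fin (γ-zero _))) (Fin↔Adding-zero d)
    step (suc zero) _ d = ↔-trans (K-reflexive (cong Fin (γ-one _))) (Fin↔Adding-one d)
    step (suc (suc n)) rec {S} d = begin
      Fin (γ (suc N) p)                                    ≡⟨ cong Fin (γ-suc N p (s≤s z≤n)) ⟩
      Fin (sum (map F (applyUpTo id (suc N))))             ≡⟨ cong (Fin ∘ sum) (map-applyUpTo id F (suc N)) ⟩
      Fin (sum (applyUpTo F (suc N)))                      ↔⟨ Fin-sum↔Σ< F (suc N) ⟩
      Σ ℕ (λ i → i < suc N × Fin (F i))                    ↔⟨ congˡ (λ {i} → congˡ (λ {i<1+N} → split i i<1+N)) ⟩
      Σ ℕ (λ i → i < suc N × Σ (Adding S i) (λ l → Adding (extend S (proj₁ l)) (N ∸ i)))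
                                                           ↔⟨ Σ-+≡↔Σ< (newCount S) (λ l → newCount (extend S l)) N ⟨
      Σ Tree (λ l → Σ Tree (λ r → childCount S l r ≡ N))   ↔⟨ Adding-node↔ d ⟨
      Adding S (suc N)                                     ∎
      where
      open Related.EquationalReasoning
      N p : ℕ
      N = suc n
      p = length S
      F : ℕ → ℕ
      F i = γ i p * γ (N ∸ i) (p + i)

      extension : ∀ {i} (l : Adding S i) → Fin (γ (N ∸ i) (p + i)) ↔ Adding (extend S (proj₁ l)) (N ∸ i)
      extension {i} (l , hl) = ↔-trans
        (K-reflexive (cong (Fin ∘ γ (N ∸ i)) (sym (trans (length-extend S l) (cong (p +_) hl)))))
        (rec (s≤s (m∸n≤m N i)) (Dictionary-extend l d))

      split : ∀ i → i < suc N → Fin (F i) ↔ Σ (Adding S i) (λ l → Adding (extend S (proj₁ l)) (N ∸ i))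
      split i i<1+N = ↔-trans *↔× (Σ-cong (rec i<1+N d) λ {x} → extension (Inverse.to (rec i<1+N d) x))

mainTheorem4 : (γ : ℕ → ℕ → ℕ)
    → (∀ p → γ 0 p ≡ p + 1)
    → (∀ p → γ 1 p ≡ p * p + p + 1)
    → (∀ n p → 1 ≤ n → γ (suc n) p ≡ gammaSum γ n p)
    → ∀ n → Fin (γ n 0) ↔ CompactedOfSize n
mainTheorem4 γ γ-zero γ-one γ-suc n = begin
  Fin (γ n 0)        ↔⟨ Fin-γ↔Adding γ γ-zero γ-one γ-suc n dictionary-[] ⟩
  Adding [] n        ↔⟨ Adding-[]↔CompactedOfSize n ⟩
  CompactedOfSize n  ∎
  where open Related.EquationalReasoning
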